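{- Let $G=(V,E)$ be an undirected graph with $n$ vertices, $\chi$ its initial coloring, $k\ge2$, $m\ge0$, and let $c$ be a color of the coloring $\chi_{\mathcal{W}[k]}^m$ obtained by $m$ iterations of $k$-walk refinement. Then there is a $\mathcal{W}_k$ formula $\varphi(x,y)$ of quantifier depth $m$ identifying $c$ in $\chi_{\mathcal{W}[k]}^m$. Moreover, $\varphi(x,y)$ only depends on $n$ and $c$ (and not on $G$).
   Context: The initial coloring of $G$ is $\chi(v,v)=-1$, $\chi(u,v)=1$ if $u\neq v$ and $\{u,v\}\in E$, $\chi(u,v)=0$ otherwise. The $k$-walk refinement maps a coloring $\chi$ to $\chi_{\mathcal{W}[k]}(u,v)=\{\!\{(\chi(u,w_1),\chi(w_1,w_2),\dots,\chi(w_{k-1},v)): w_1,\dots,w_{k-1}\in V\}\!\}$, so colors are formal objects (the initial values $-1,0,1$, and multisets of $k$-tuples of earlier colors), comparable across graphs; $\chi_{\mathcal{W}[k]}^m$ is the $m$-fold iterate. The $k$-walk counting logic $\mathcal{W}_k$ uses a set $\mathcal{V}$ of $k+1$ variables; its formulas with free variables among $z_1,z_{k+1}\in\mathcal V$ are given by $\varphi(z_1,z_{k+1})::= z_1=z_{k+1}\mid z_1\sim z_{k+1}\mid \varphi(z_1,z_{k+1})\wedge\varphi(z_1,z_{k+1})\mid\neg\varphi(z_1,z_{k+1})\mid \exists^j(z_2,\dots,z_k).\ \bigwedge_{i\in[k]}\varphi_i(z_i,z_{i+1})$, where $j\in\mathbb N$, $z_1,\dots,z_{k+1}\in\mathcal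 V$ are pairwise distinct, and each $\varphi_i(z_i,z_{i+1})$ is a formula with free variables among $z_i,z_{i+1}$. Variables range over vertices, $\sim$ is adjacency, and the walk quantifier $\exists^j(z_2,\dots,z_k)$ holds iff at least $j$ distinct tuples $(v_2,\dots,v_k)$ of vertices satisfy the conjunction. Quantifier depth is the maximal nesting depth of walk quantifiers. A formula $\varphi(x,y)$ identifies color $c$ in a coloring $\chi'$ of $V^2$ if for all $u,v\in V$: $\varphi(u,v)$ holds iff $\chi'(u,v)=c$. -}

module Defs where

open import Data.Bool using (Bool; true; false; if_then_else_; _∧_; not)
open import Data.Nat using (ℕ; zero; suc; _∸_; _⊔_; _≤ᵇ_)
open import Data.Integer using (ℤ; +_; -[1+_])
open import Data.Fin using (Fin; zero; suc; inject₁; _≟_)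
open import Data.List using (List; []; _∷_; map; concatMap; allFin; length; filterᵇ; take; drop)
open import Data.Vec as Vec using (Vec; lookup; toList)
open import Data.List.Relation.Binary.Pointwise using (Pointwise)
open import Data.List.Relation.Binary.Permutation.Homogeneous using (Permutation)
open import Relation.Nullary.Decidable using (⌊_⌋)
open import Relation.Binary.PropositionalEquality using (_≡_)
open import Data.Sum using (_⊎_)
import Data.Fin

record Graph (n : ℕ) : Set where
  field
    adj    : Fin n → Fin n → Bool
    sym    : ∀ u v → adj u v ≡ adj v u
    irrefl : ∀ u → adj u u ≡ false

open Graph public

-- Colours as formal objects: initial values -1,0,1, or a multiset
-- (represented by a list) of k-tuples (represented by lists) of colours.

data Color : Set where
  base : ℤ → Color
  node : List (List Color) → Color

data _≈_ : Color → Color → Set where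
  base≈ : ∀ {i} → base i ≈ base i
  node≈ : ∀ {xs ys} → Permutation (Pointwise _≈_) xs ys → node xs ≈ node ys

allTuples : (n j : ℕ) → List (List (Fin n))
allTuples n zero    = [] ∷ []
allTuples n (suc j) = concatMap (λ w → map (w ∷_) (allTuples n j)) (allFin n)

initColoring : ∀ {n} → Graph n → Fin n → Fin n → Color
initColoring G u v =
  if ⌊ u ≟ v ⌋ then base -[1+ 0 ]
  else (if adj G u v then base (+ 1) else base (+ 0))

walkColors : ∀ {n} → (Fin n → Fin n → Color) → Fin n → List (Fin n) → Fin n → List Color
walkColors χ u []       v = χ u v ∷ []
walkColors χ u (w ∷ ws) v = χ u w ∷ walkColors χ w ws v

walkRefine : ∀ {n} (k : ℕ) → (Fin n → Fin n → Color) → Fin n → Fin n → Color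
walkRefine {n} k χ u v = node (map (λ ws → walkColors χ u ws v) (allTuples n (k ∸ 1)))

iterColoring : ∀ {n} (k m : ℕ) → Graph n → Fin n → Fin n → Color
iterColoring k zero    G = initColoring G
iterColoring k (suc m) G = walkRefine k (iterColoring k m G)

Var : ℕ → Set
Var k = Fin (suc k)

data Form (k : ℕ) : Set where
  _≐_  : Var k → Var k → Form k
  _∼_  : Var k → Var k → Form k
  _∧ᶠ_ : Form k → Form k → Form k
  ¬ᶠ_  : Form k → Form k
  -- ∃^j (z₂,…,z_k). ⋀_{i∈[k]} φᵢ(zᵢ,z_{i+1}),  with zs = (z₁,…,z_{k+1})
  ∃walk : ℕ → Vec (Var k) (suc k) → Vec (Form k) k → Form k

data WF {k : ℕ} (x y : Var k) : Form k → Set where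
  eqF  : ∀ {a b} → (a ≡ x ⊎ a ≡ y) → (b ≡ x ⊎ b ≡ y) → WF x y (a ≐ b)
  adjF : ∀ {a b} → (a ≡ x ⊎ a ≡ y) → (b ≡ x ⊎ b ≡ y) → WF x y (a ∼ b)
  andF : ∀ {φ ψ} → WF x y φ → WF x y ψ → WF x y (φ ∧ᶠ ψ)
  negF : ∀ {φ} → WF x y φ → WF x y (¬ᶠ φ)
  walkF : ∀ {j} {zs : Vec (Var k) (suc k)} {φs : Vec (Form k) k} →
          (∀ i i′ → lookup zs i ≡ lookup zs i′ → i ≡ i′) →
          (lookup zs zero ≡ x ⊎ lookup zs zero ≡ y) →
          (lookup zs (Data.Fin.fromℕ k) ≡ x ⊎ lookup zs (Data.Fin.fromℕ k) ≡ y) →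
          (∀ (i : Fin k) → WF (lookup zs (inject₁ i)) (lookup zs (suc i)) (lookup φs i)) →
          WF x y (∃walk j zs φs)

update : ∀ {n k} → (Var k → Fin n) → List (Var k) → List (Fin n) → (Var k → Fin n)
update α []       _        = α
update α (z ∷ zs) []       = α
update α (z ∷ zs) (w ∷ ws) = update (λ z′ → if ⌊ z′ ≟ z ⌋ then w else α z′) zs ws

innerVars : ∀ {k} → Vec (Var k) (suc k) → List (Var k)
innerVars {k} zs = drop 1 (take k (toList zs))

count : ∀ {A : Set} → (A → Bool) → List A → ℕ
count p xs = length (filterᵇ p xs)

mutual
  eval : ∀ {n k} → Graph n → (Var k → Fin n) → Form k → Bool
  eval G α (a ≐ b)  = ⌊ α a ≟ α b ⌋
  eval G α (a ∼ b)  = adj G (α a) (α b)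
  eval G α (φ ∧ᶠ ψ) = eval G α φ ∧ eval G α ψ
  eval G α (¬ᶠ φ)   = not (eval G α φ)
  eval {n} {k} G α (∃walk j zs φs) =
    j ≤ᵇ count (λ ws → evalAll G (update α (innerVars zs) ws) φs) (allTuples n (k ∸ 1))

  evalAll : ∀ {n k m} → Graph n → (Var k → Fin n) → Vec (Form k) m → Bool
  evalAll G α Vec.[]       = true
  evalAll G α (φ Vec.∷ φs) = eval G α φ ∧ evalAll G α φs

mutual
  depth : ∀ {k} → Form k → ℕ
  depth (a ≐ b)        = 0
  depth (a ∼ b)        = 0
  depth (φ ∧ᶠ ψ)       = depth φ ⊔ depth ψ
  depth (¬ᶠ φ)         = depth φ
  depth (∃walk j zs φs) = suc (depthAll φs)

  depthAll : ∀ {k m} → Vec (Form k) m → ℕ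
  depthAll Vec.[]       = 0
  depthAll (φ Vec.∷ φs) = depth φ ⊔ depthAll φs

-- the assignment x ↦ u, y ↦ v (other variables ↦ v; irrelevant for
-- well-formed formulas with free variables among x, y)
assign : ∀ {n k} → Var k → Var k → Fin n → Fin n → (Var k → Fin n)
assign x y u v z = if ⌊ z ≟ x ⌋ then u else v

module Submission where

open import Defs using (count)
open import Data.Bool using (Bool; true; false; not; _∧_; T; if_then_else_)
open import Data.Nat using (ℕ; zero; suc; _≤ᵇ_; _≤_; _⊔_; _∸_; s≤s)
open import Data.Nat.Properties
  using (⊔-identityʳ; ⊔-idem; suc-injective; ≤-antisym; ≮⇒≥; n≮n; ≤-refl; ≤ᵇ-reflects-≤)
open import Data.Fin using (Fin; zero; suc; fromℕ; inject₁; _≟_)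
open import Data.Fin.Permutation.Components using (transpose; transpose-inverse)
import Data.Integer as ℤ
open import Data.List using (List; []; _∷_; _++_; [_]; length; map; take; tabulate; replicate; allFin)
open import Data.List.Properties using (length-map; map-++; length-replicate)
open import Data.List.Relation.Unary.All using (All; []; _∷_)
import Data.List.Relation.Unary.All as All
open import Data.List.Relation.Unary.All.Properties using (map⁺; concat⁺)
open import Data.List.Relation.Unary.AllPairs using ([]; _∷_)
open import Data.List.Relation.Unary.Any using (here; there; any?)
import Data.List.Relation.Unary.Any as Any
open import Data.List.Relation.Unary.Linked using (Linked; _∷_)
open import Data.List.Relation.Unary.Linked.Properties using (AllPairs⇒Linked)
open import Data.List.Relation.Unary.Unique.Propositional using (Unique)
import Data.List.Relation.Unary.Unique.Propositional.Properties as Unique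
open import Data.List.Relation.Binary.Pointwise using (Pointwise; []; _∷_)
import Data.List.Relation.Binary.Equality.Setoid as ListSetoid
open import Data.List.Relation.Binary.Permutation.Homogeneous using (Permutation)
import Data.List.Relation.Binary.Permutation.Homogeneous as Perm
import Data.List.Relation.Binary.Permutation.Setoid as SetoidPerm
open import Data.List.Relation.Binary.Permutation.Setoid.Properties using (Unique-resp-↭; ∷↭∷ʳ)
open import Data.Vec as Vec using (Vec; lookup; toList)
open import Data.Vec.Properties using (lookup∘tabulate)
open import Data.Product using (Σ; ∃; _×_; _,_; proj₁; proj₂; uncurry)
open import Data.Sum using (inj₁; inj₂)
open import Level using (0ℓ)
open import Function.Bundles using (_⇔_; mk⇔; Equivalence)
open import Relation.Binary.Bundles using (Setoid; DecSetoid)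
open import Relation.Binary.Definitions using (Reflexive; Symmetric; Transitive; Decidable)
open import Relation.Binary.PropositionalEquality
  using (_≡_; _≢_; refl; sym; trans; cong; cong₂; subst; subst₂; module ≡-Reasoning)
open import Relation.Binary.PropositionalEquality.Properties using (setoid)
open import Relation.Nullary using (Dec; yes; no; ¬_; contradiction; ofʸ; ofⁿ)
open import Relation.Nullary.Decidable using (⌊_⌋; T?; map′; _×-dec_; dec-true; dec-false)

-- The colour χᵐ⁺¹(a, b) is the multiset of the colour
-- tuples of the walks a w₁ … w_{k-1} b, and two equally long lists are equal as multisets
-- iff every element of one occurs equally often in both.  So the next formula says, for
-- every walk w of G, that exactly N_w tuples (z₂, …, z_k) make each step zᵢ zᵢ₊₁ satisfy
-- the level-m formula of the i-th step of w, N_w being the multiplicity of the colour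
-- tuple of w; the walk quantifier runs over a vector of all k + 1 variables that starts
-- with x and ends with y.

∧-true⇔ : ∀ {a b} → (a ∧ b ≡ true) ⇔ (a ≡ true × b ≡ true)
∧-true⇔ {true}  {true}  = mk⇔ (λ _ → refl , refl) (λ _ → refl)
∧-true⇔ {true}  {false} = mk⇔ (λ ()) (λ ())
∧-true⇔ {false}         = mk⇔ (λ ()) (λ ())

≡does : ∀ {P : Set} {b} → (b ≡ true) ⇔ P → (P? : Dec P) → b ≡ ⌊ P? ⌋
≡does {b = true}  _   (yes _)  = refl
≡does {b = false} _   (no _)   = refl
≡does {b = true}  b⇔P (no ¬p)  = contradiction (Equivalence.to b⇔P refl) ¬p
≡does {b = false} b⇔P (yes p)  = Equivalence.from b⇔P p

≤ᵇ-exactly : ∀ j c → ((j ≤ᵇ c) ∧ not (suc j ≤ᵇ c) ≡ true) ⇔ (c ≡ j)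
≤ᵇ-exactly j c with j ≤ᵇ c | ≤ᵇ-reflects-≤ j c | suc j ≤ᵇ c | ≤ᵇ-reflects-≤ (suc j) c
... | true  | ofʸ j≤c | false | ofⁿ j≮c = mk⇔ (λ _ → ≤-antisym (≮⇒≥ j≮c) j≤c) (λ _ → refl)
... | true  | ofʸ _   | true  | ofʸ j<c = mk⇔ (λ ()) (λ { refl → contradiction j<c (n≮n j) })
... | false | ofⁿ j≰c | _     | _       = mk⇔ (λ ()) (λ { refl → contradiction ≤-refl j≰c })

length-snoc : ∀ {A : Set} (xs : List A) x → length (xs ++ [ x ]) ≡ suc (length xs)
length-snoc []       x = refl
length-snoc (_ ∷ xs) x = cong suc (length-snoc xs x)

count-∷-cancel : ∀ {A : Set} (p : A → Bool) x {xs ys} →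
                 count p (x ∷ xs) ≡ count p (x ∷ ys) → count p xs ≡ count p ys
count-∷-cancel p x e with p x
... | true  = suc-injective e
... | false = e

count-map : ∀ {A B : Set} (p : B → Bool) (f : A → B) xs → count p (map f xs) ≡ count (λ x → p (f x)) xs
count-map p f [] = refl
count-map p f (x ∷ xs) with p (f x)
... | true  = cong suc (count-map p f xs)
... | false = count-map p f xs

count-cong : ∀ {A : Set} {p q : A → Bool} {xs} → All (λ x → p x ≡ q x) xs → count p xs ≡ count q xs
count-cong [] = refl
count-cong {p = p} {q} {x ∷ _} (_ ∷ _) with p x | q x
count-cong (refl ∷ es) | true  | true  = cong suc (count-cong es)
count-cong (refl ∷ es) | false | false = count-cong es

module Multisets {ℓ} (S : Setoid 0ℓ ℓ) where

  open Setoid S using (_≈_) renaming (Carrier to A; refl to ≈-refl; sym to ≈-sym)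
  open import Data.List.Membership.Setoid S using (_∈_)
  open import Data.List.Membership.Setoid.Properties using (∈-∃++)
  open SetoidPerm S using (_↭_; prep; ↭-refl; ↭-sym; ↭-trans; ↭-reflexive-≋)
  open import Data.List.Relation.Binary.Permutation.Setoid.Properties S
    using (shift; filter⁺; xs↭ys⇒|xs|≡|ys|; ∈-resp-↭; drop-∷)

  ∈⇒↭∷ : ∀ {x xs} → x ∈ xs → ∃ λ xs′ → xs ↭ x ∷ xs′
  ∈⇒↭∷ x∈xs with ∈-∃++ S x∈xs
  ... | as , bs , _ , x≈w , xs≋ = as ++ bs , ↭-trans (↭-reflexive-≋ xs≋) (shift (≈-sym x≈w) as bs)

  count-resp-↭ : ∀ (p : A → Bool) → (∀ {x y} → x ≈ y → p x ≡ p y) →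
                 ∀ {xs ys} → xs ↭ ys → count p xs ≡ count p ys
  count-resp-↭ p p-resp xs↭ys =
    xs↭ys⇒|xs|≡|ys| (filter⁺ (λ x → T? (p x)) (λ x≈y → subst T (p-resp x≈y)) xs↭ys)

  ↭-dec : ∀ {ys} → All (λ y → ∀ x → Dec (x ≈ y)) ys → ∀ xs → Dec (xs ↭ ys)
  ↭-dec [] []      = yes ↭-refl
  ↭-dec [] (_ ∷ _) = no λ p → contradiction (xs↭ys⇒|xs|≡|ys| p) λ ()
  ↭-dec {y ∷ _} (_≈y? ∷ ds) xs with any? _≈y? xs
  ... | no y∉xs = no λ p → y∉xs (Any.map ≈-sym (∈-resp-↭ (↭-sym p) (here ≈-refl)))
  ... | yes y∈xs with ∈⇒↭∷ (Any.map ≈-sym y∈xs)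
  ...   | xs′ , xs↭ with ↭-dec ds xs′
  ...     | yes xs′↭ys = yes (↭-trans xs↭ (prep ≈-refl xs′↭ys))
  ...     | no xs′↭̸ys = no λ p → xs′↭̸ys (drop-∷ (↭-trans (↭-sym xs↭) p))

module DecMultisets {ℓ} (D : DecSetoid 0ℓ ℓ) where

  open DecSetoid D using (_≈_)
    renaming (Carrier to A; setoid to S; _≟_ to _≈?_; refl to ≈-refl; sym to ≈-sym; trans to ≈-trans)
  open Multisets S using (∈⇒↭∷; count-resp-↭)
  open import Data.List.Membership.Setoid S using (_∈_)
  open SetoidPerm S using (_↭_; prep; ↭-refl; ↭-trans)
  open import Data.List.Relation.Binary.Permutation.Setoid.Properties S using (xs↭ys⇒|xs|≡|ys|)

  multiplicity : A → List A → ℕ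
  multiplicity y = count (λ x → ⌊ x ≈? y ⌋)

  ≈?-resp : ∀ {y x x′} → x ≈ x′ → ⌊ x ≈? y ⌋ ≡ ⌊ x′ ≈? y ⌋
  ≈?-resp {y} {x} {x′} x≈x′ with x ≈? y | x′ ≈? y
  ... | yes _   | yes _    = refl
  ... | no _    | no _     = refl
  ... | yes x≈y | no x′≉y  = contradiction (≈-trans (≈-sym x≈x′) x≈y) x′≉y
  ... | no x≉y  | yes x′≈y = contradiction (≈-trans x≈x′ x′≈y) x≉y

  multiplicity-resp-↭ : ∀ y {xs ys} → xs ↭ ys → multiplicity y xs ≡ multiplicity y ys
  multiplicity-resp-↭ y = count-resp-↭ _ ≈?-resp

  multiplicity-self : ∀ y ys → multiplicity y (y ∷ ys) ≡ suc (multiplicity y ys)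
  multiplicity-self y ys with y ≈? y
  ... | yes _   = refl
  ... | no y≉y  = contradiction ≈-refl y≉y

  multiplicity≡suc⇒∈ : ∀ {y c} xs → multiplicity y xs ≡ suc c → y ∈ xs
  multiplicity≡suc⇒∈ {y} (x ∷ xs) e with x ≈? y
  ... | yes x≈y = here (≈-sym x≈y)
  ... | no _    = there (multiplicity≡suc⇒∈ xs e)

  counts⇒↭ : ∀ {xs} ys → length xs ≡ length ys →
             All (λ y → multiplicity y xs ≡ multiplicity y ys) ys → xs ↭ ys
  counts⇒↭ {[]} [] _ _ = ↭-refl
  counts⇒↭ {xs} (y ∷ ys) |xs|≡ (mult-y ∷ mults) =
    ↭-trans xs↭ (prep ≈-refl (counts⇒↭ ys |xs′|≡ (All.map drop-y mults)))
    where
    y∈xs : y ∈ xs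
    y∈xs = multiplicity≡suc⇒∈ xs (trans mult-y (multiplicity-self y ys))
    xs′ = proj₁ (∈⇒↭∷ y∈xs)
    xs↭ = proj₂ (∈⇒↭∷ y∈xs)
    |xs′|≡ : length xs′ ≡ length ys
    |xs′|≡ = suc-injective (trans (sym (xs↭ys⇒|xs|≡|ys| xs↭)) |xs|≡)
    drop-y : ∀ {t} → multiplicity t xs ≡ multiplicity t (y ∷ ys) → multiplicity t xs′ ≡ multiplicity t ys
    drop-y {t} e = count-∷-cancel (λ x → ⌊ x ≈? t ⌋) y (trans (sym (multiplicity-resp-↭ t xs↭)) e)

open Defs hiding (count; sym)

_≋_ : List Color → List Color → Set
_≋_ = Pointwise _≈_

mutual
  ≈-refl : Reflexive _≈_
  ≈-refl {base _}  = base≈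
  ≈-refl {node ts} = node≈ (Perm.refl (≋*-refl ts))

  ≋-refl : Reflexive _≋_
  ≋-refl {[]}    = []
  ≋-refl {_ ∷ _} = ≈-refl ∷ ≋-refl

  ≋*-refl : ∀ ts → Pointwise _≋_ ts ts
  ≋*-refl []       = []
  ≋*-refl (_ ∷ ts) = ≋-refl ∷ ≋*-refl ts

mutual
  ≈-sym : Symmetric _≈_
  ≈-sym base≈     = base≈
  ≈-sym (node≈ p) = node≈ (≋-↭-sym p)

  ≋-sym : Symmetric _≋_
  ≋-sym []       = []
  ≋-sym (e ∷ es) = ≈-sym e ∷ ≋-sym es

  ≋*-sym : Symmetric (Pointwise _≋_)
  ≋*-sym []       = []
  ≋*-sym (e ∷ es) = ≋-sym e ∷ ≋*-sym es

  ≋-↭-sym : Symmetric (Permutation _≋_)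
  ≋-↭-sym (Perm.refl es)      = Perm.refl (≋*-sym es)
  ≋-↭-sym (Perm.prep e p)     = Perm.prep (≋-sym e) (≋-↭-sym p)
  ≋-↭-sym (Perm.swap e₁ e₂ p) = Perm.swap (≋-sym e₂) (≋-sym e₁) (≋-↭-sym p)
  ≋-↭-sym (Perm.trans p q)    = Perm.trans (≋-↭-sym q) (≋-↭-sym p)

≈-trans : Transitive _≈_
≈-trans base≈     base≈     = base≈
≈-trans (node≈ p) (node≈ q) = node≈ (Perm.trans p q)

colour-setoid : Setoid 0ℓ 0ℓ
colour-setoid = record
  { Carrier = Color ; _≈_ = _≈_
  ; isEquivalence = record { refl = ≈-refl ; sym = ≈-sym ; trans = ≈-trans } }

tuple-setoid : Setoid 0ℓ 0ℓ
tuple-setoid = ListSetoid.≋-setoid colour-setoid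

-- Recursion on the second argument: the multiset comparison needs deciders only for the
-- tuples of the right-hand multiset, which are structurally smaller.
mutual
  _≈?_ : Decidable _≈_
  base i ≈? base j   = map′ (λ { refl → base≈ }) (λ { base≈ → refl }) (i ℤ.≟ j)
  base _ ≈? node _   = no λ ()
  node _ ≈? base _   = no λ ()
  node ss ≈? node ts =
    map′ node≈ (λ { (node≈ p) → p }) (Multisets.↭-dec tuple-setoid (≋-deciders ts) ss)

  ≋-deciders : ∀ ts → All (λ t → ∀ s → Dec (s ≋ t)) ts
  ≋-deciders []       = []
  ≋-deciders (t ∷ ts) = (_≋? t) ∷ ≋-deciders ts

  _≋?_ : Decidable _≋_
  []       ≋? []       = yes []
  []       ≋? (_ ∷ _)  = no λ ()
  (_ ∷ _)  ≋? []       = no λ ()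
  (c ∷ cs) ≋? (d ∷ ds) = map′ (uncurry _∷_) (λ { (e ∷ es) → e , es }) ((c ≈? d) ×-dec (cs ≋? ds))

tuple-decSetoid : DecSetoid 0ℓ 0ℓ
tuple-decSetoid = record
  { Carrier = List Color ; _≈_ = _≋_
  ; isDecEquivalence = record { isEquivalence = Setoid.isEquivalence tuple-setoid ; _≟_ = _≋?_ } }

toList-tabulate : ∀ {A : Set} {r} (f : Fin r → A) → toList (Vec.tabulate f) ≡ tabulate f
toList-tabulate {r = zero}  f = refl
toList-tabulate {r = suc r} f = cong (f zero ∷_) (toList-tabulate (λ i → f (suc i)))

toList-take-last : ∀ {A : Set} {r} (xs : Vec A (suc r)) →
                   toList xs ≡ take r (toList xs) ++ [ lookup xs (fromℕ r) ]
toList-take-last {r = zero}  (x Vec.∷ Vec.[]) = refl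
toList-take-last {r = suc r} (x Vec.∷ xs)     = cong (x ∷_) (toList-take-last xs)

length-take-toList : ∀ {A : Set} {r} (xs : Vec A (suc r)) → length (take r (toList xs)) ≡ r
length-take-toList {r = zero}  (x Vec.∷ Vec.[]) = refl
length-take-toList {r = suc r} (x Vec.∷ xs)     = cong suc (length-take-toList xs)

toList-innerVars : ∀ {k} (zs : Vec (Var (suc k)) (suc (suc k))) →
                   toList zs ≡ lookup zs zero ∷ innerVars zs ++ [ lookup zs (fromℕ (suc k)) ]
toList-innerVars (z Vec.∷ zs) = cong (z ∷_) (toList-take-last zs)

length-innerVars : ∀ {k} (zs : Vec (Var (suc k)) (suc (suc k))) → length (innerVars zs) ≡ k
length-innerVars (z Vec.∷ zs) = length-take-toList zs

module _ {n k : ℕ} where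

  update-∉ : ∀ (α : Var k → Fin n) {vs z} ws → All (z ≢_) vs → update α vs ws z ≡ α z
  update-∉ α {[]}    _  _ = refl
  update-∉ α {_ ∷ _} [] _ = refl
  update-∉ α {v ∷ vs} {z} (w ∷ ws) (z≢v ∷ z∉vs) = trans (update-∉ _ ws z∉vs) α-at-z
    where
    α-at-z : (if ⌊ z ≟ v ⌋ then w else α z) ≡ α z
    α-at-z with z ≟ v
    ... | yes z≡v = contradiction z≡v z≢v
    ... | no _    = refl

  map-update : ∀ (α : Var k → Fin n) {vs} ws → Unique vs → length ws ≡ length vs →
               map (update α vs ws) vs ≡ ws
  map-update α [] [] _ = refl
  map-update α {v ∷ vs} (w ∷ ws) (v∉vs ∷ vs-unique) |ws|≡ =
    cong₂ _∷_ (trans (update-∉ _ ws v∉vs) w-at-v) (map-update _ ws vs-unique (suc-injective |ws|≡))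
    where
    w-at-v : (if ⌊ v ≟ v ⌋ then w else α v) ≡ w
    w-at-v with v ≟ v
    ... | yes _   = refl
    ... | no v≢v  = contradiction refl v≢v

module _ {r : ℕ} where

  transpose-hit : (i j : Fin r) → transpose i j i ≡ j
  transpose-hit i j rewrite dec-true (i ≟ i) refl = refl

  transpose-miss : ∀ {i j l : Fin r} → l ≢ i → l ≢ j → transpose i j l ≡ l
  transpose-miss {i} {j} {l} l≢i l≢j rewrite dec-false (l ≟ i) l≢i | dec-false (l ≟ j) l≢j = refl

  transpose-injective : ∀ (i j : Fin r) {l l′} → transpose i j l ≡ transpose i j l′ → l ≡ l′
  transpose-injective i j e =
    trans (sym (transpose-inverse j i)) (trans (cong (transpose j i) e) (transpose-inverse j i))

⋀ : ∀ {k} {A : Set} → (A → Form k) → A → List A → Form k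
⋀ g a []        = g a
⋀ g a (a′ ∷ as) = g a ∧ᶠ ⋀ g a′ as

exactly : ∀ {k} → ℕ → Vec (Var k) (suc k) → Vec (Form k) k → Form k
exactly j zs φs = ∃walk j zs φs ∧ᶠ (¬ᶠ ∃walk (suc j) zs φs)

module _ {k} {A : Set} (g : A → Form k) where

  WF-⋀ : ∀ {x y} → (∀ a → WF x y (g a)) → ∀ a as → WF x y (⋀ g a as)
  WF-⋀ g-WF a []        = g-WF a
  WF-⋀ g-WF a (a′ ∷ as) = andF (g-WF a) (WF-⋀ g-WF a′ as)

  depth-⋀ : ∀ {d} → (∀ a → depth (g a) ≡ d) → ∀ a as → depth (⋀ g a as) ≡ d
  depth-⋀ g-depth a []            = g-depth a
  depth-⋀ {d} g-depth a (a′ ∷ as) = trans (cong₂ _⊔_ (g-depth a) (depth-⋀ g-depth a′ as)) (⊔-idem d)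

  eval-⋀ : ∀ {n} (H : Graph n) α a as →
           (eval H α (⋀ g a as) ≡ true) ⇔ All (λ b → eval H α (g b) ≡ true) (a ∷ as)
  eval-⋀ H α a []        = mk⇔ (λ e → e ∷ []) (λ { (e ∷ []) → e })
  eval-⋀ H α a (a′ ∷ as) = mk⇔
    (λ e → let e₁ , e₂ = Equivalence.to ∧-true⇔ e in e₁ ∷ Equivalence.to (eval-⋀ H α a′ as) e₂)
    (λ { (e ∷ es) → Equivalence.from ∧-true⇔ (e , Equivalence.from (eval-⋀ H α a′ as) es) })

eval-exactly : ∀ {n k} (H : Graph n) α j {zs : Vec (Var k) (suc k)} {φs} →
  (eval H α (exactly j zs φs) ≡ true) ⇔
  (count (λ ws → evalAll H (update α (innerVars zs) ws) φs) (allTuples n (k ∸ 1)) ≡ j)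
eval-exactly H α j = ≤ᵇ-exactly j _

module WalkRefinement (n k : ℕ) where

  V : Set
  V = Var (suc k)

  lastVar : Fin (suc (suc k))
  lastVar = fromℕ (suc k)

  -- Move x to position 0, then y to the last position; when x ≢ y the second step fixes 0.
  walkVar : V → V → Fin (suc (suc k)) → V
  walkVar x y i = transpose zero x (transpose lastVar (transpose x zero y) i)

  walkVars : V → V → Vec V (suc (suc k))
  walkVars x y = Vec.tabulate (walkVar x y)

  module _ {x y : V} where

    walkVar-injective : ∀ {i j} → walkVar x y i ≡ walkVar x y j → i ≡ j
    walkVar-injective e = transpose-injective _ _ (transpose-injective _ _ e)

    walkVar-last : walkVar x y lastVar ≡ y
    walkVar-last = trans (cong (transpose zero x) (transpose-hit lastVar _)) (transpose-inverse zero x)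

    lookup-walkVars-injective : ∀ i j → lookup (walkVars x y) i ≡ lookup (walkVars x y) j → i ≡ j
    lookup-walkVars-injective i j e =
      walkVar-injective (trans (sym (lookup∘tabulate (walkVar x y) i)) (trans e (lookup∘tabulate (walkVar x y) j)))

    lookup-walkVars-last : lookup (walkVars x y) lastVar ≡ y
    lookup-walkVars-last = trans (lookup∘tabulate (walkVar x y) lastVar) walkVar-last

    walkVars-unique : Unique (toList (walkVars x y))
    walkVars-unique = subst Unique (sym (toList-tabulate (walkVar x y))) (Unique.tabulate⁺ walkVar-injective)

    module _ (x≢y : x ≢ y) where

      private
        inner = innerVars (walkVars x y)

      walkVar-zero : walkVar x y zero ≡ x
      walkVar-zero =
        trans (cong (transpose zero x) (transpose-miss {i = lastVar} (λ ()) 0≢y′)) (transpose-hit zero x)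
        where
        0≢y′ : zero ≢ transpose x zero y
        0≢y′ 0≡y′ = x≢y (begin
          x                                     ≡⟨ transpose-hit zero x ⟨
          transpose zero x zero                 ≡⟨ cong (transpose zero x) 0≡y′ ⟩
          transpose zero x (transpose x zero y) ≡⟨ transpose-inverse zero x ⟩
          y                                     ∎)
          where open ≡-Reasoning

      toList-walkVars : toList (walkVars x y) ≡ x ∷ inner ++ [ y ]
      toList-walkVars = trans (toList-innerVars (walkVars x y))
        (cong₂ (λ u v → u ∷ inner ++ [ v ]) walkVar-zero lookup-walkVars-last)

      innerVars-fresh : All (x ≢_) inner × All (y ≢_) inner × Unique inner
      innerVars-fresh
        with Unique-resp-↭ (setoid V) x∷inner∷y↭x∷y∷inner (subst Unique toList-walkVars walkVars-unique)
        where
        open SetoidPerm (setoid V) using (_↭_; ↭-prep; ↭-sym)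
        x∷inner∷y↭x∷y∷inner : x ∷ inner ++ [ y ] ↭ x ∷ y ∷ inner
        x∷inner∷y↭x∷y∷inner = ↭-prep x (↭-sym (∷↭∷ʳ (setoid V) y inner))
      ... | (_ ∷ x∉inner) ∷ y∉inner ∷ inner-unique = x∉inner , y∉inner , inner-unique

      map-update-walkVars : ∀ (α : V → Fin n) ws → length ws ≡ k →
        map (update α inner ws) (toList (walkVars x y)) ≡ α x ∷ ws ++ [ α y ]
      map-update-walkVars α ws |ws|≡k = begin
        map β (toList (walkVars x y))  ≡⟨ cong (map β) toList-walkVars ⟩
        β x ∷ map β (inner ++ [ y ])   ≡⟨ cong (β x ∷_) (map-++ β inner [ y ]) ⟩
        β x ∷ map β inner ++ [ β y ]   ≡⟨ cong₂ (λ u us → u ∷ us ++ [ β y ]) (update-∉ α ws x∉inner)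
                                               (map-update α ws inner-unique |ws|≡|inner|) ⟩
        α x ∷ ws ++ [ β y ]            ≡⟨ cong (λ v → α x ∷ ws ++ [ v ]) (update-∉ α ws y∉inner) ⟩
        α x ∷ ws ++ [ α y ]            ∎
        where
        open ≡-Reasoning
        β = update α inner ws
        x∉inner = proj₁ innerVars-fresh
        y∉inner = proj₁ (proj₂ innerVars-fresh)
        inner-unique = proj₂ (proj₂ innerVars-fresh)
        |ws|≡|inner| = trans |ws|≡k (sym (length-innerVars (walkVars x y)))

  pathColors : (Fin n → Fin n → Color) → List (Fin n) → List Color
  pathColors c (u ∷ v ∷ ps) = c u v ∷ pathColors c (v ∷ ps)
  pathColors c _            = []

  walkColors-pathColors : ∀ c u ws v → walkColors c u ws v ≡ pathColors c (u ∷ ws ++ [ v ])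
  walkColors-pathColors c u []       v = refl
  walkColors-pathColors c u (w ∷ ws) v = cong (c u w ∷_) (walkColors-pathColors c w ws v)

  Tuples : List (List (Fin n))
  Tuples = allTuples n k

  allTuples-length : ∀ j → All (λ ws → length ws ≡ j) (allTuples n j)
  allTuples-length zero    = refl ∷ []
  allTuples-length (suc j) =
    concat⁺ (map⁺ (All.universal (λ _ → map⁺ (All.map (cong suc) (allTuples-length j))) (allFin n)))

  walkTuples : (Fin n → Fin n → Color) → Fin n → Fin n → List (List Color)
  walkTuples c u v = map (λ ws → walkColors c u ws v) Tuples

  χ : ℕ → Graph n → Fin n → Fin n → Color
  χ m H = iterColoring (suc k) m H

  Family : Set
  Family = Fin n → Fin n → V → V → Form (suc k)

  Identifies : ℕ → Graph n → Family → Set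
  Identifies m G f = ∀ a b x y → x ≢ y → ∀ H α →
    (eval H α (f a b x y) ≡ true) ⇔ (χ m H (α x) (α y) ≈ χ m G a b)

  module Chain (f : Family) where

    -- The middle clause only applies to paths that are too short; it is never reached.
    chain : ∀ {r} → Fin n → Vec V (suc r) → List (Fin n) → Vec (Form (suc k)) r
    chain p (z Vec.∷ Vec.[])      _         = Vec.[]
    chain p (z Vec.∷ z′ Vec.∷ zs) []        = f p p z z′ Vec.∷ chain p (z′ Vec.∷ zs) []
    chain p (z Vec.∷ z′ Vec.∷ zs) (p′ ∷ ps) = f p p′ z z′ Vec.∷ chain p′ (z′ Vec.∷ zs) ps

    module _ {d} (f-depth : ∀ a b x y → depth (f a b x y) ≡ d) where

      chain-depth : ∀ {r} p (zs : Vec V (suc (suc r))) ps → depthAll (chain p zs ps) ≡ d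
      chain-depth p (z Vec.∷ z′ Vec.∷ Vec.[]) []       = trans (⊔-identityʳ _) (f-depth p p z z′)
      chain-depth p (z Vec.∷ z′ Vec.∷ Vec.[]) (p′ ∷ _) = trans (⊔-identityʳ _) (f-depth p p′ z z′)
      chain-depth p (z Vec.∷ z′ Vec.∷ zs@(_ Vec.∷ _)) [] =
        trans (cong₂ _⊔_ (f-depth p p z z′) (chain-depth p (z′ Vec.∷ zs) [])) (⊔-idem d)
      chain-depth p (z Vec.∷ z′ Vec.∷ zs@(_ Vec.∷ _)) (p′ ∷ ps) =
        trans (cong₂ _⊔_ (f-depth p p′ z z′) (chain-depth p′ (z′ Vec.∷ zs) ps)) (⊔-idem d)

    module _ (f-WF : ∀ a b x y → x ≢ y → WF x y (f a b x y)) where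

      chain-WF : ∀ {r} p (zs : Vec V (suc r)) ps → Linked _≢_ (toList zs) →
                 ∀ i → WF (lookup zs (inject₁ i)) (lookup zs (suc i)) (lookup (chain p zs ps) i)
      chain-WF p (z Vec.∷ z′ Vec.∷ zs) []        (z≢z′ ∷ _)      zero    = f-WF p p z z′ z≢z′
      chain-WF p (z Vec.∷ z′ Vec.∷ zs) (p′ ∷ ps) (z≢z′ ∷ _)      zero    = f-WF p p′ z z′ z≢z′
      chain-WF p (z Vec.∷ z′ Vec.∷ zs) []        (_ ∷ linked) (suc i) = chain-WF p (z′ Vec.∷ zs) [] linked i
      chain-WF p (z Vec.∷ z′ Vec.∷ zs) (p′ ∷ ps) (_ ∷ linked) (suc i) = chain-WF p′ (z′ Vec.∷ zs) ps linked i

    module _ {m G} (f-identifies : Identifies m G f) where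

      chain-sem : ∀ {r} p (zs : Vec V (suc r)) ps → Linked _≢_ (toList zs) → length ps ≡ r → ∀ H β →
        (evalAll H β (chain p zs ps) ≡ true) ⇔
        (pathColors (χ m H) (map β (toList zs)) ≋ pathColors (χ m G) (p ∷ ps))
      chain-sem p (z Vec.∷ Vec.[]) [] _ _ H β = mk⇔ (λ _ → []) (λ _ → refl)
      chain-sem p (z Vec.∷ z′ Vec.∷ zs) (p′ ∷ ps) (z≢z′ ∷ linked) |ps|≡ H β = mk⇔
        (λ e → let e₁ , e₂ = Equivalence.to ∧-true⇔ e in Equivalence.to first⇔ e₁ ∷ Equivalence.to rest⇔ e₂)
        (λ { (c ∷ cs) → Equivalence.from ∧-true⇔ (Equivalence.from first⇔ c , Equivalence.from rest⇔ cs) })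
        where
        first⇔ = f-identifies p p′ z z′ z≢z′ H β
        rest⇔  = chain-sem p′ (z′ Vec.∷ zs) ps linked (suc-injective |ps|≡) H β

  open DecMultisets tuple-decSetoid using (multiplicity; multiplicity-resp-↭; counts⇒↭)

  walkCountFormula : Family → (Fin n → Fin n → Color) →
                     Fin n → Fin n → V → V → List (Fin n) → Form (suc k)
  walkCountFormula f c a b x y w =
    exactly (multiplicity (walkColors c a w b) (walkTuples c a b))
            (walkVars x y) (Chain.chain f a (walkVars x y) (w ++ [ b ]))

  -- The conjunct for the walk replicate k a (one of the Tuples) keeps the conjunction
  -- nonempty, so its depth is exactly one more than that of f.
  refine : Family → (Fin n → Fin n → Color) → Family
  refine f c a b x y = ⋀ (walkCountFormula f c a b x y) (replicate k a) Tuples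

  module _ (f : Family) (c : Fin n → Fin n → Color) where
    open Chain f

    refine-depth : ∀ {m} → (∀ a b x y → depth (f a b x y) ≡ m) →
                   ∀ a b x y → depth (refine f c a b x y) ≡ suc m
    refine-depth f-depth a b x y = depth-⋀ (walkCountFormula f c a b x y)
      (λ w → trans (⊔-idem _) (cong suc (chain-depth f-depth a (walkVars x y) (w ++ [ b ]))))
      (replicate k a) Tuples

    refine-WF : (∀ a b x y → x ≢ y → WF x y (f a b x y)) →
                ∀ a b x y → x ≢ y → WF x y (refine f c a b x y)
    refine-WF f-WF a b x y x≢y =
      WF-⋀ (walkCountFormula f c a b x y) (λ w → andF (walk-WF w) (negF (walk-WF w))) (replicate k a) Tuples
      where
      walk-WF : ∀ {j} w → WF x y (∃walk j (walkVars x y) (chain a (walkVars x y) (w ++ [ b ])))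
      walk-WF w = walkF (lookup-walkVars-injective {x} {y})
        (inj₁ (walkVar-zero x≢y)) (inj₂ (lookup-walkVars-last {x} {y}))
        (chain-WF f-WF a (walkVars x y) (w ++ [ b ]) (AllPairs⇒Linked (walkVars-unique {x} {y})))

  module _ (m : ℕ) (G : Graph n) (f : Family) (f-identifies : Identifies m G f)
           (a b : Fin n) (x y : V) (x≢y : x ≢ y) (H : Graph n) (α : V → Fin n) where
    open Chain f

    private
      zs = walkVars x y
      β = update α (innerVars zs)
      LH = walkTuples (χ m H) (α x) (α y)
      LG = walkTuples (χ m G) a b
      tupleG = λ w → walkColors (χ m G) a w b

    walk-sem : ∀ w → length w ≡ k → ∀ ws → length ws ≡ k →
      (evalAll H (β ws) (chain a zs (w ++ [ b ])) ≡ true) ⇔ (walkColors (χ m H) (α x) ws (α y) ≋ tupleG w)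
    walk-sem w |w|≡k ws |ws|≡k =
      subst₂ (λ s t → (evalAll H (β ws) (chain a zs (w ++ [ b ])) ≡ true) ⇔ (s ≋ t))
        (trans (cong (pathColors (χ m H)) (map-update-walkVars x≢y α ws |ws|≡k))
               (sym (walkColors-pathColors (χ m H) (α x) ws (α y))))
        (sym (walkColors-pathColors (χ m G) a w b))
        (chain-sem {m} {G} f-identifies a zs (w ++ [ b ]) (AllPairs⇒Linked (walkVars-unique {x} {y}))
                   (trans (length-snoc w b) (cong suc |w|≡k)) H (β ws))

    walkCount : ∀ w → length w ≡ k →
      count (λ ws → evalAll H (β ws) (chain a zs (w ++ [ b ]))) Tuples ≡ multiplicity (tupleG w) LH
    walkCount w |w|≡k = trans
      (count-cong (All.map (λ |ws|≡k → ≡does (walk-sem w |w|≡k _ |ws|≡k) _) (allTuples-length k)))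
      (sym (count-map _ _ Tuples))

    walkCountFormula-sem : ∀ w → length w ≡ k →
      (eval H α (walkCountFormula f (χ m G) a b x y w) ≡ true) ⇔
      (multiplicity (tupleG w) LH ≡ multiplicity (tupleG w) LG)
    walkCountFormula-sem w |w|≡k =
      subst (λ c → (eval H α (exactly N zs φs) ≡ true) ⇔ (c ≡ N))
            (walkCount w |w|≡k) (eval-exactly H α N {zs} {φs})
      where
      N = multiplicity (tupleG w) LG
      φs = chain a zs (w ++ [ b ])

    refine-sem : (eval H α (refine f (χ m G) a b x y) ≡ true) ⇔ (node LH ≈ node LG)
    refine-sem = mk⇔
      (λ e → node≈ (counts⇒↭ LG |LH|≡|LG| (map⁺ (All.zipWith
        (λ (|w|≡k , holds) → Equivalence.to (walkCountFormula-sem _ |w|≡k) holds)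
        (allTuples-length k , All.tail (Equivalence.to conjuncts e))))))
      (λ { (node≈ LH↭LG) → Equivalence.from conjuncts (All.map
        (λ |w|≡k → Equivalence.from (walkCountFormula-sem _ |w|≡k) (multiplicity-resp-↭ _ LH↭LG))
        (length-replicate k ∷ allTuples-length k)) })
      where
      conjuncts = eval-⋀ (walkCountFormula f (χ m G) a b x y) H α (replicate k a) Tuples
      |LH|≡|LG| = trans (length-map _ Tuples) (sym (length-map _ Tuples))

  identify : ℕ → Graph n → Family
  identify zero G a b x y with a ≟ b | adj G a b
  ... | yes _ | _     = x ≐ y
  ... | no _  | true  = (¬ᶠ (x ≐ y)) ∧ᶠ (x ∼ y)
  ... | no _  | false = (¬ᶠ (x ≐ y)) ∧ᶠ (¬ᶠ (x ∼ y))
  identify (suc m) G = refine (identify m G) (χ m G)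

  identify-depth : ∀ m G a b x y → depth (identify m G a b x y) ≡ m
  identify-depth zero G a b x y with a ≟ b | adj G a b
  ... | yes _ | _     = refl
  ... | no _  | true  = refl
  ... | no _  | false = refl
  identify-depth (suc m) G = refine-depth (identify m G) (χ m G) (identify-depth m G)

  identify-WF : ∀ m G a b x y → x ≢ y → WF x y (identify m G a b x y)
  identify-WF zero G a b x y _ with a ≟ b | adj G a b
  ... | yes _ | _     = eqF (inj₁ refl) (inj₂ refl)
  ... | no _  | true  = andF (negF (eqF (inj₁ refl) (inj₂ refl))) (adjF (inj₁ refl) (inj₂ refl))
  ... | no _  | false = andF (negF (eqF (inj₁ refl) (inj₂ refl))) (negF (adjF (inj₁ refl) (inj₂ refl)))
  identify-WF (suc m) G = refine-WF (identify m G) (χ m G) (identify-WF m G)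

  identify-zero-sem : ∀ G a b x y (H : Graph n) (α : V → Fin n) →
    (eval H α (identify zero G a b x y) ≡ true) ⇔ (initColoring H (α x) (α y) ≈ initColoring G a b)
  identify-zero-sem G a b x y H α with a ≟ b | adj G a b
  ... | yes _ | _ with α x ≟ α y | adj H (α x) (α y)
  ...   | yes _ | _     = mk⇔ (λ _ → base≈) (λ _ → refl)
  ...   | no _  | true  = mk⇔ (λ ()) (λ ())
  ...   | no _  | false = mk⇔ (λ ()) (λ ())
  identify-zero-sem G a b x y H α | no _ | true with α x ≟ α y | adj H (α x) (α y)
  ...   | yes _ | _     = mk⇔ (λ ()) (λ ())
  ...   | no _  | true  = mk⇔ (λ _ → base≈) (λ _ → refl)
  ...   | no _  | false = mk⇔ (λ ()) (λ ())
  identify-zero-sem G a b x y H α | no _ | false with α x ≟ α y | adj H (α x) (α y)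
  ...   | yes _ | _     = mk⇔ (λ ()) (λ ())
  ...   | no _  | true  = mk⇔ (λ ()) (λ ())
  ...   | no _  | false = mk⇔ (λ _ → base≈) (λ _ → refl)

  identify-sem : ∀ m G → Identifies m G (identify m G)
  identify-sem zero    G a b x y _ = identify-zero-sem G a b x y
  identify-sem (suc m) G = refine-sem m G (identify m G) (identify-sem m G)

-- The construction works for every k ≥ 1; the hypothesis 2 ≤ k is only used to write k = suc k.
lemma13 : (n k : ℕ) → 2 ≤ k → (m : ℕ) → (G : Graph n) → (u₀ v₀ : Fin n) →
    Σ (Var k) λ x → Σ (Var k) λ y → ¬ (x ≡ y) × Σ (Form k) λ φ →
      WF x y φ × depth φ ≡ m ×
      ((H : Graph n) (u v : Fin n) →
        (eval H (assign x y u v) φ ≡ true) ⇔ (iterColoring k m H u v ≈ iterColoring k m G u₀ v₀))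
lemma13 n (suc k) (s≤s _) m G u₀ v₀ =
  zero , suc zero , (λ ()) , identify m G u₀ v₀ zero (suc zero) ,
  identify-WF m G u₀ v₀ zero (suc zero) (λ ()) , identify-depth m G u₀ v₀ zero (suc zero) ,
  λ H u v → identify-sem m G u₀ v₀ zero (suc zero) (λ ()) H (assign zero (suc zero) u v)
  where open WalkRefinement n k
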